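{- For all $n\ge1$: (OE) $c_i(L_{2n})=1$ and $c_i(L_{2n}+1)=1$ hold simultaneously if and only if $i=0$ or $i=-2n$; (EO) there is no index $i\in\{ -2n-2,\dots,2n+2\}$ with $c_i(L_{2n+1})=1$ and $c_i(L_{2n+1}+1)=1$.
   Context: Let $\varphi=(1+\sqrt5)/2$. Lucas numbers: $L_0=2$, $L_1=1$, $L_n=L_{n-1}+L_{n-2}$. The Bergman representation $\beta(N)$ is the unique finite expansion $N=\sum_i d_i\varphi^i$ with digits in $\{0,1\}$ and no two consecutive digits $11$. The canonical representation $\gamma(N)$: if $N$ has a finite representation $N=\sum_ic_i\varphi^i$ with digits in $\{0,1\}$, $c_1=c_0=1$, and $c_{i+1}c_i\ne11$ for all $i\ne0$, then $\gamma(N)$ is this (unique) representation; otherwise $\gamma(N)=\beta(N)$. $c_i(N)$ denotes the digit of index $i$ in $\gamma(N)$, taken to be $0$ for indices outside the range of nonzero digits. -}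

module Defs where

open import Data.Nat as ℕ using (ℕ; zero; suc)
open import Data.Integer as ℤ using (ℤ; +_; -[1+_]; _+_; _-_; -_)
open import Data.Bool using (Bool; true; false)
open import Data.List using (List; []; _∷_)
open import Data.Product using (_×_; Σ)
open import Data.Sum using (_⊎_)
open import Relation.Binary.PropositionalEquality using (_≡_; _≢_)
open import Relation.Nullary using (¬_)

L : ℕ → ℕ
L zero = 2
L (suc zero) = 1
L (suc (suc n)) = L (suc n) ℕ.+ L n

-- Elements a + bφ of ℤ[φ], represented by the pair (a , b).
record ℤφ : Set where
  constructor _⊕_φ
  field
    re : ℤ
    im : ℤ

open ℤφ public

_+φ_ : ℤφ → ℤφ → ℤφ
(a ⊕ b φ) +φ (c ⊕ d φ) = (a + c) ⊕ (b + d) φ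

zeroφ oneφ : ℤφ
zeroφ = (+ 0) ⊕ (+ 0) φ
oneφ  = (+ 1) ⊕ (+ 0) φ

-- multiplication by φ : φ(a + bφ) = b + (a+b)φ   (φ² = φ + 1)
mulφ : ℤφ → ℤφ
mulφ (a ⊕ b φ) = b ⊕ (a + b) φ

-- multiplication by φ⁻¹ = φ - 1 : (a + bφ)(φ - 1) = (b - a) + aφ
divφ : ℤφ → ℤφ
divφ (a ⊕ b φ) = (b - a) ⊕ a φ

iter : ℕ → (ℤφ → ℤφ) → ℤφ → ℤφ
iter zero f x = x
iter (suc n) f x = f (iter n f x)

φ^ : ℤ → ℤφ
φ^ (+ n) = iter n mulφ oneφ
φ^ -[1+ n ] = iter (suc n) divφ oneφ

embed : ℕ → ℤφ
embed N = (+ N) ⊕ (+ 0) φ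

-- A finite base-φ representation with digits in {0,1}:
-- (k , d₀ ∷ d₁ ∷ … ∷ dₘ) stands for Σⱼ dⱼ φ^(k+j).
Rep : Set
Rep = ℤ × List Bool

valueFrom : ℤ → List Bool → ℤφ
valueFrom k [] = zeroφ
valueFrom k (false ∷ ds) = valueFrom (k + + 1) ds
valueFrom k (true ∷ ds) = φ^ k +φ valueFrom (k + + 1) ds

value : Rep → ℤφ
value (k Data.Product., ds) = valueFrom k ds

nth : ℕ → List Bool → Bool
nth n [] = false
nth zero (d ∷ ds) = d
nth (suc n) (d ∷ ds) = nth n ds

lookupℤ : ℤ → List Bool → Bool
lookupℤ (+ n) ds = nth n ds
lookupℤ -[1+ n ] ds = false

-- digit of index i (false = 0 outside the listed range)
digit : Rep → ℤ → Bool
digit (k Data.Product., ds) i = lookupℤ (i - k) ds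

Represents : ℕ → Rep → Set
Represents N r = value r ≡ embed N

NoAdj11 : Rep → Set
NoAdj11 r = ∀ i → digit r (i + + 1) ≡ true → digit r i ≡ false

Special : Rep → Set
Special r = digit r (+ 1) ≡ true × digit r (+ 0) ≡ true
          × (∀ i → i ≢ + 0 → digit r (i + + 1) ≡ true → digit r i ≡ false)

IsBergman : ℕ → Rep → Set
IsBergman N r = Represents N r × NoAdj11 r

IsCanonical : ℕ → Rep → Set
IsCanonical N r =
    (Represents N r × Special r)
  ⊎ ((¬ Σ Rep (λ s → Represents N s × Special s)) × IsBergman N r)

-- Binet's formula in ℤ[φ] gives L(2n) = φ²ⁿ + φ⁻²ⁿ and L(2n+1) = φ²ⁿ⁺¹ − φ⁻²ⁿ⁻¹, from which one writes
-- down Bergman representations of L(2n), L(2n)+1, L(2n+1), L(2n+1)+1 and a special representation of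
-- L(2n); (OE) and (EO) are then read off these digit strings. They are the canonical representations
-- by uniqueness: after shifting all digits to indices ≥ 2 the imaginary part of a representation is a
-- Fibonacci sum, so Zeckendorf's theorem makes Bergman representations unique. Erasing the digit φ⁰
-- of a special representation of N leaves the Bergman representation of N − 1, which therefore has
-- digit 1 at φ¹. This makes special representations unique and rules them out for L(2n)+1 and
-- L(2n+1)+1 (where β(N − 1) has digit 0 at φ¹) and for L(2n+1) (where erasing φ⁰ from β(N), whose
-- digits at φ⁰ and φ¹ are 1 and 0, gives a second Bergman representation of N − 1).

module Submission where

open import Defs
open import Data.Nat using (ℕ; _≤_; _*_)
open import Data.Nat as ℕ using (zero; suc; _<_; z≤n; s≤s)
open import Data.Integer as ℤ using (ℤ; +_; -[1+_]; _+_; _-_; -_)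
open import Data.Bool using (Bool; true; false; if_then_else_)
open import Data.Product using (_×_; _,_; Σ; proj₁)
open import Data.Sum using (_⊎_; inj₁; inj₂)
open import Data.List using (List; []; _∷_; _++_; length; replicate)
import Data.List.Properties as LP
open import Function.Bundles using (_⇔_; mk⇔)
open import Data.Empty using (⊥-elim)
open import Function using (flip; _∘_)
open import Relation.Binary.PropositionalEquality
open import Relation.Nullary using (¬_; yes; no)
import Data.Integer.Properties as ℤP
import Data.Nat.Properties as ℕP
open import Algebra.Bundles using (AbelianGroup)
open import Algebra.Properties.Group (AbelianGroup.group ℤP.+-0-abelianGroup) using (∙-cancelˡ)
open import Data.Integer.Solver using (module +-*-Solver)
open +-*-Solver

+φ-comm : ∀ x y → x +φ y ≡ y +φ x
+φ-comm (a ⊕ b φ) (c ⊕ d φ) = cong₂ _⊕_φ (ℤP.+-comm a c) (ℤP.+-comm b d)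

+φ-assoc : ∀ x y z → (x +φ y) +φ z ≡ x +φ (y +φ z)
+φ-assoc (a ⊕ b φ) (c ⊕ d φ) (e ⊕ f φ) = cong₂ _⊕_φ (ℤP.+-assoc a c e) (ℤP.+-assoc b d f)

+φ-identityˡ : ∀ x → zeroφ +φ x ≡ x
+φ-identityˡ (a ⊕ b φ) = cong₂ _⊕_φ (ℤP.+-identityˡ a) (ℤP.+-identityˡ b)

+φ-identityʳ : ∀ x → x +φ zeroφ ≡ x
+φ-identityʳ (a ⊕ b φ) = cong₂ _⊕_φ (ℤP.+-identityʳ a) (ℤP.+-identityʳ b)

+φ-cancelˡ : ∀ z {x y} → z +φ x ≡ z +φ y → x ≡ y
+φ-cancelˡ (a ⊕ b φ) {c ⊕ d φ} {e ⊕ f φ} eq =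
  cong₂ _⊕_φ (∙-cancelˡ a c e (cong re eq)) (∙-cancelˡ b d f (cong im eq))

+φ-interchange : ∀ w x y z → (w +φ x) +φ (y +φ z) ≡ (w +φ y) +φ (x +φ z)
+φ-interchange (a ⊕ a′ φ) (b ⊕ b′ φ) (c ⊕ c′ φ) (d ⊕ d′ φ) = cong₂ _⊕_φ (interchange a b c d) (interchange a′ b′ c′ d′)
  where
  interchange : ∀ a b c d → (a + b) + (c + d) ≡ (a + c) + (b + d)
  interchange = solve 4 (λ a b c d → (a :+ b) :+ (c :+ d) := (a :+ c) :+ (b :+ d)) refl

mulφ-distrib-+φ : ∀ x y → mulφ (x +φ y) ≡ mulφ x +φ mulφ y
mulφ-distrib-+φ (a ⊕ b φ) (c ⊕ d φ) =
  cong₂ _⊕_φ refl (solve 4 (λ a b c d → (a :+ c) :+ (b :+ d) := (a :+ b) :+ (c :+ d)) refl a b c d)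

mulφ-divφ : ∀ x → mulφ (divφ x) ≡ x
mulφ-divφ (a ⊕ b φ) = cong₂ _⊕_φ refl (solve 2 (λ a b → (b :- a) :+ a := b) refl a b)

mulφ-golden : ∀ x → x +φ mulφ x ≡ mulφ (mulφ x)
mulφ-golden _ = refl

embed-+1 : ∀ N → embed (N ℕ.+ 1) ≡ oneφ +φ embed N
embed-+1 N = cong₂ _⊕_φ (cong +_ (ℕP.+-comm N 1)) refl

-- Multiplication by the conjugate ψ = 1 - φ = -φ⁻¹.
mulψ : ℤφ → ℤφ
mulψ (a ⊕ b φ) = (a - b) ⊕ (- a) φ

mulψ-golden : ∀ x → x +φ mulψ x ≡ mulψ (mulψ x)
mulψ-golden (a ⊕ b φ) = cong₂ _⊕_φ
  (solve 2 (λ a b → a :+ (a :- b) := (a :- b) :- (:- a)) refl a b)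
  (solve 2 (λ a b → b :+ (:- a) := :- (a :- b)) refl a b)

mulψ-mulψ : ∀ x → mulψ (mulψ x) ≡ divφ (divφ x)
mulψ-mulψ (a ⊕ b φ) = cong₂ _⊕_φ
  (solve 2 (λ a b → (a :- b) :- (:- a) := a :- (b :- a)) refl a b)
  (solve 2 (λ a b → :- (a :- b) := b :- a) refl a b)

mulψ-+φ-divφ : ∀ x → mulψ x +φ divφ x ≡ zeroφ
mulψ-+φ-divφ (a ⊕ b φ) = cong₂ _⊕_φ
  (solve 2 (λ a b → (a :- b) :+ (b :- a) := con (+ 0)) refl a b)
  (solve 1 (λ a → (:- a) :+ a := con (+ 0)) refl a)

φ^-suc : ∀ j → φ^ (j + + 1) ≡ mulφ (φ^ j)
φ^-suc (+ n) rewrite ℕP.+-comm n 1 = refl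
φ^-suc -[1+ zero ] = sym (mulφ-divφ oneφ)
φ^-suc -[1+ suc n ] = sym (mulφ-divφ _)

φ^-neg-suc : ∀ j → φ^ (- + suc j) ≡ divφ (φ^ (- + j))
φ^-neg-suc zero = refl
φ^-neg-suc (suc j) = refl

φ^-golden : ∀ k → φ^ k +φ φ^ (k + + 1) ≡ φ^ (k + + 2)
φ^-golden k = begin
  φ^ k +φ φ^ (k + + 1)    ≡⟨ cong (φ^ k +φ_) (φ^-suc k) ⟩
  φ^ k +φ mulφ (φ^ k)     ≡⟨ mulφ-golden (φ^ k) ⟩
  mulφ (mulφ (φ^ k))      ≡⟨ cong mulφ (sym (φ^-suc k)) ⟩
  mulφ (φ^ (k + + 1))     ≡⟨ sym (φ^-suc (k + + 1)) ⟩
  φ^ (k + + 1 + + 1)      ≡⟨ cong φ^ (ℤP.+-assoc k (+ 1) (+ 1)) ⟩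
  φ^ (k + + 2)            ∎
  where open ≡-Reasoning

ψ^ : ℕ → ℤφ
ψ^ m = iter m mulψ oneφ

Lucas-Binet : ∀ m → embed (L m) ≡ φ^ (+ m) +φ ψ^ m
Lucas-Binet zero = refl
Lucas-Binet (suc zero) = refl
Lucas-Binet (suc (suc m)) = begin
  embed (L (suc m)) +φ embed (L m)                       ≡⟨ +φ-comm (embed (L (suc m))) (embed (L m)) ⟩
  embed (L m) +φ embed (L (suc m))                       ≡⟨ cong₂ _+φ_ (Lucas-Binet m) (Lucas-Binet (suc m)) ⟩
  (φ^ (+ m) +φ ψ^ m) +φ (φ^ (+ suc m) +φ ψ^ (suc m))     ≡⟨ +φ-interchange (φ^ (+ m)) (ψ^ m) (φ^ (+ suc m)) (ψ^ (suc m)) ⟩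
  (φ^ (+ m) +φ φ^ (+ suc m)) +φ (ψ^ m +φ ψ^ (suc m))     ≡⟨ cong (φ^ (+ suc (suc m)) +φ_) (mulψ-golden (ψ^ m)) ⟩
  φ^ (+ suc (suc m)) +φ ψ^ (suc (suc m))                 ∎
  where open ≡-Reasoning

ψ^-even : ∀ n → ψ^ (n ℕ.+ n) ≡ φ^ (- + (n ℕ.+ n))
ψ^-even zero = refl
ψ^-even (suc n) rewrite ℕP.+-suc n n = begin
  mulψ (mulψ (ψ^ (n ℕ.+ n)))               ≡⟨ mulψ-mulψ (ψ^ (n ℕ.+ n)) ⟩
  divφ (divφ (ψ^ (n ℕ.+ n)))               ≡⟨ cong (λ y → divφ (divφ y)) (ψ^-even n) ⟩
  divφ (divφ (φ^ (- + (n ℕ.+ n))))         ≡⟨ cong divφ (sym (φ^-neg-suc (n ℕ.+ n))) ⟩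
  divφ (φ^ (- + suc (n ℕ.+ n)))            ≡⟨ sym (φ^-neg-suc (suc (n ℕ.+ n))) ⟩
  φ^ (- + suc (suc (n ℕ.+ n)))             ∎
  where open ≡-Reasoning

Lucas-even : ∀ n → embed (L (n ℕ.+ n)) ≡ φ^ (+ (n ℕ.+ n)) +φ φ^ (- + (n ℕ.+ n))
Lucas-even n = trans (Lucas-Binet (n ℕ.+ n)) (cong (φ^ (+ (n ℕ.+ n)) +φ_) (ψ^-even n))

Lucas-odd : ∀ n → embed (L (suc (n ℕ.+ n))) +φ φ^ (- + suc (n ℕ.+ n)) ≡ φ^ (+ suc (n ℕ.+ n))
Lucas-odd n = begin
  embed (L (suc m)) +φ φ^ (- + suc m)         ≡⟨ cong₂ _+φ_ (Lucas-Binet (suc m)) (φ^-neg-suc m) ⟩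
  (φ^ (+ suc m) +φ mulψ (ψ^ m)) +φ divφ φ⁻ᵐ   ≡⟨ cong (λ y → (φ^ (+ suc m) +φ mulψ y) +φ divφ φ⁻ᵐ) (ψ^-even n) ⟩
  (φ^ (+ suc m) +φ mulψ φ⁻ᵐ) +φ divφ φ⁻ᵐ      ≡⟨ +φ-assoc (φ^ (+ suc m)) (mulψ φ⁻ᵐ) (divφ φ⁻ᵐ) ⟩
  φ^ (+ suc m) +φ (mulψ φ⁻ᵐ +φ divφ φ⁻ᵐ)      ≡⟨ cong (φ^ (+ suc m) +φ_) (mulψ-+φ-divφ φ⁻ᵐ) ⟩
  φ^ (+ suc m) +φ zeroφ                       ≡⟨ +φ-identityʳ (φ^ (+ suc m)) ⟩
  φ^ (+ suc m)                                ∎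
  where
  open ≡-Reasoning
  m = n ℕ.+ n
  φ⁻ᵐ = φ^ (- + m)

zeros : ℕ → List Bool
zeros d = replicate d false

alternating : ℕ → List Bool
alternating zero = []
alternating (suc m) = true ∷ false ∷ alternating m

valueFrom-mulφ : ∀ j ds → mulφ (valueFrom j ds) ≡ valueFrom (j + + 1) ds
valueFrom-mulφ j [] = refl
valueFrom-mulφ j (false ∷ ds) = valueFrom-mulφ (j + + 1) ds
valueFrom-mulφ j (true ∷ ds) = trans (mulφ-distrib-+φ (φ^ j) _)
  (cong₂ _+φ_ (sym (φ^-suc j)) (valueFrom-mulφ (j + + 1) ds))

valueFrom-iter-mulφ : ∀ K j ds → iter K mulφ (valueFrom j ds) ≡ valueFrom (j + + K) ds
valueFrom-iter-mulφ zero j ds = cong (flip valueFrom ds) (sym (ℤP.+-identityʳ j))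
valueFrom-iter-mulφ (suc K) j ds = begin
  mulφ (iter K mulφ (valueFrom j ds))  ≡⟨ cong mulφ (valueFrom-iter-mulφ K j ds) ⟩
  mulφ (valueFrom (j + + K) ds)        ≡⟨ valueFrom-mulφ (j + + K) ds ⟩
  valueFrom (j + + K + + 1) ds         ≡⟨ cong (flip valueFrom ds) (ℤP.+-assoc j (+ K) (+ 1)) ⟩
  valueFrom (j + + (K ℕ.+ 1)) ds       ≡⟨ cong (λ k → valueFrom (j + + k) ds) (ℕP.+-comm K 1) ⟩
  valueFrom (j + + suc K) ds           ∎
  where open ≡-Reasoning

valueFrom-zeros++ : ∀ d j ds → valueFrom j (zeros d ++ ds) ≡ valueFrom (j + + d) ds
valueFrom-zeros++ zero j ds = cong (flip valueFrom ds) (sym (ℤP.+-identityʳ j))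
valueFrom-zeros++ (suc d) j ds =
  trans (valueFrom-zeros++ d (j + + 1) ds) (cong (flip valueFrom ds) (ℤP.+-assoc j (+ 1) (+ d)))

valueFrom-++ : ∀ j xs ys → valueFrom j (xs ++ ys) ≡ valueFrom j xs +φ valueFrom (j + + length xs) ys
valueFrom-++ j [] ys = trans (cong (flip valueFrom ys) (sym (ℤP.+-identityʳ j))) (sym (+φ-identityˡ _))
valueFrom-++ j (false ∷ xs) ys = trans (valueFrom-++ (j + + 1) xs ys)
  (cong (λ k → valueFrom (j + + 1) xs +φ valueFrom k ys) (ℤP.+-assoc j (+ 1) (+ length xs)))
valueFrom-++ j (true ∷ xs) ys = trans (cong (φ^ j +φ_) (valueFrom-++ (j + + 1) xs ys))
  (trans (cong (λ k → φ^ j +φ (valueFrom (j + + 1) xs +φ valueFrom k ys)) (ℤP.+-assoc j (+ 1) (+ length xs)))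
    (sym (+φ-assoc (φ^ j) _ _)))

length-alternating : ∀ m → length (alternating m) ≡ m ℕ.+ m
length-alternating zero = refl
length-alternating (suc m) = cong suc (trans (cong suc (length-alternating m)) (sym (ℕP.+-suc m m)))

valueFrom-true∷zeros++ : ∀ k d R → valueFrom k (true ∷ zeros d ++ R) ≡ φ^ k +φ valueFrom (k + + suc d) R
valueFrom-true∷zeros++ k d R = cong (φ^ k +φ_)
  (trans (valueFrom-zeros++ d (k + + 1) R) (cong (flip valueFrom R) (ℤP.+-assoc k (+ 1) (+ d))))

-- φ^k + φ^(k+1) + φ^(k+3) + … + φ^(k+2m-1) telescopes to φ^(k+2m).
φ^-+-valueFrom-alternating : ∀ m k → φ^ k +φ valueFrom (k + + 1) (alternating m) ≡ φ^ (k + + m + + m)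
φ^-+-valueFrom-alternating zero k =
  trans (+φ-identityʳ (φ^ k)) (cong φ^ (solve 1 (λ k → k := k :+ con (+ 0) :+ con (+ 0)) refl k))
φ^-+-valueFrom-alternating (suc m) k = begin
  φ^ k +φ (φ^ (k + + 1) +φ valueFrom (k + + 1 + + 1 + + 1) (alternating m))
    ≡⟨ sym (+φ-assoc (φ^ k) _ _) ⟩
  (φ^ k +φ φ^ (k + + 1)) +φ valueFrom (k + + 1 + + 1 + + 1) (alternating m)
    ≡⟨ cong₂ _+φ_ (φ^-golden k) (cong (flip valueFrom (alternating m))
         (solve 1 (λ k → k :+ con (+ 1) :+ con (+ 1) :+ con (+ 1) := k :+ con (+ 2) :+ con (+ 1)) refl k)) ⟩
  φ^ (k + + 2) +φ valueFrom (k + + 2 + + 1) (alternating m)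
    ≡⟨ φ^-+-valueFrom-alternating m (k + + 2) ⟩
  φ^ (k + + 2 + + m + + m)
    ≡⟨ cong φ^ (solve 2 (λ k m → k :+ con (+ 2) :+ m :+ m := k :+ (con (+ 1) :+ m) :+ (con (+ 1) :+ m)) refl k (+ m)) ⟩
  φ^ (k + + suc m + + suc m) ∎
  where open ≡-Reasoning

-- Fibonacci sums and Zeckendorf uniqueness

fib : ℕ → ℕ
fib zero = 0
fib (suc zero) = 1
fib (suc (suc n)) = fib n ℕ.+ fib (suc n)

im-φ^ : ∀ p → im (φ^ (+ p)) ≡ + fib p
im-φ^ zero = refl
im-φ^ (suc zero) = refl
im-φ^ (suc (suc p)) = cong₂ _+_ (im-φ^ p) (im-φ^ (suc p))

iter-mulφ-+φ : ∀ K x y → iter K mulφ (x +φ y) ≡ iter K mulφ x +φ iter K mulφ y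
iter-mulφ-+φ zero x y = refl
iter-mulφ-+φ (suc K) x y = trans (cong mulφ (iter-mulφ-+φ K x y)) (mulφ-distrib-+φ (iter K mulφ x) (iter K mulφ y))

fibSum : ℕ → (ℕ → Bool) → ℕ → ℕ
fibSum p f zero = 0
fibSum p f (suc m) = fibSum p f m ℕ.+ (if f m then fib (p ℕ.+ m) else 0)

fibSum-head : ∀ p f m →
  fibSum p f (suc m) ≡ (if f 0 then fib p else 0) ℕ.+ fibSum (suc p) (f ∘ suc) m
fibSum-head p f zero rewrite ℕP.+-identityʳ p = ℕP.+-comm 0 _
fibSum-head p f (suc m) rewrite fibSum-head p f m | ℕP.+-suc p m =
  ℕP.+-assoc (if f 0 then fib p else 0) _ _

im-valueFrom : ∀ p ds → im (valueFrom (+ p) ds) ≡ + fibSum p (flip nth ds) (length ds)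
im-valueFrom p [] = refl
im-valueFrom p (false ∷ ds) rewrite fibSum-head p (flip nth (false ∷ ds)) (length ds) | ℕP.+-comm p 1 =
  im-valueFrom (suc p) ds
im-valueFrom p (true ∷ ds) rewrite fibSum-head p (flip nth (true ∷ ds)) (length ds) | ℕP.+-comm p 1 =
  cong₂ _+_ (im-φ^ p) (im-valueFrom (suc p) ds)

NoAdj : (ℕ → Bool) → Set
NoAdj f = ∀ t → f (suc t) ≡ true → f t ≡ false

NoAdjExcept : ℕ → (ℕ → Bool) → Set
NoAdjExcept c f = ∀ t → t ≢ c → f (suc t) ≡ true → f t ≡ false

VanishesFrom : ℕ → (ℕ → Bool) → Set
VanishesFrom M f = ∀ t → M ≤ t → f t ≡ false

nth-vanishes : ∀ ds → VanishesFrom (length ds) (flip nth ds)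
nth-vanishes [] _ _ = refl
nth-vanishes (d ∷ ds) (suc t) (s≤s le) = nth-vanishes ds t le

fibSum-vanishing : ∀ {p f n} → VanishesFrom n f → ∀ m → n ≤ m → fibSum p f m ≡ fibSum p f n
fibSum-vanishing {p} {f} {n} f0 m n≤m with ℕP.m≤n⇒m<n∨m≡n n≤m
... | inj₂ refl = refl
... | inj₁ (s≤s {n = m′} n≤m′) rewrite f0 m′ n≤m′ =
  trans (ℕP.+-identityʳ _) (fibSum-vanishing f0 m′ n≤m′)

fibSum-cong : ∀ {p f g} m → (∀ t → t < m → f t ≡ g t) → fibSum p f m ≡ fibSum p g m
fibSum-cong zero eq = refl
fibSum-cong {p} (suc m) eq = cong₂ (λ s b → s ℕ.+ (if b then fib (p ℕ.+ m) else 0))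
  (fibSum-cong m (λ t t<m → eq t (ℕP.m≤n⇒m≤1+n t<m))) (eq m (ℕP.n<1+n m))

fibSum-< : ∀ {f} m → NoAdj f → fibSum 2 f m < fib (2 ℕ.+ m)
fibSum-< zero na = s≤s z≤n
fibSum-< {f} (suc m) na with f m in fm
... | false = begin-strict
  fibSum 2 f m ℕ.+ 0             ≡⟨ ℕP.+-identityʳ _ ⟩
  fibSum 2 f m                   <⟨ fibSum-< m na ⟩
  fib (2 ℕ.+ m)                  ≤⟨ ℕP.m≤n+m _ (fib (suc m)) ⟩
  fib (suc m) ℕ.+ fib (2 ℕ.+ m)  ∎
  where open ℕP.≤-Reasoning
fibSum-< {f} (suc zero) na | true = s≤s (s≤s z≤n)
fibSum-< {f} (suc (suc m)) na | true rewrite na m fm = begin-strict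
  fibSum 2 f m ℕ.+ 0 ℕ.+ fib (3 ℕ.+ m)  ≡⟨ cong (ℕ._+ fib (3 ℕ.+ m)) (ℕP.+-identityʳ (fibSum 2 f m)) ⟩
  fibSum 2 f m ℕ.+ fib (3 ℕ.+ m)        <⟨ ℕP.+-monoˡ-< (fib (3 ℕ.+ m)) (fibSum-< m na) ⟩
  fib (2 ℕ.+ m) ℕ.+ fib (3 ℕ.+ m)       ∎
  where open ℕP.≤-Reasoning

fibSum-<-top : ∀ {f g} m → NoAdj g → fibSum 2 g m ℕ.+ 0 < fibSum 2 f m ℕ.+ fib (2 ℕ.+ m)
fibSum-<-top {f} {g} m ng = begin-strict
  fibSum 2 g m ℕ.+ 0               ≡⟨ ℕP.+-identityʳ _ ⟩
  fibSum 2 g m                     <⟨ fibSum-< m ng ⟩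
  fib (2 ℕ.+ m)                    ≤⟨ ℕP.m≤n+m (fib (2 ℕ.+ m)) (fibSum 2 f m) ⟩
  fibSum 2 f m ℕ.+ fib (2 ℕ.+ m)   ∎
  where open ℕP.≤-Reasoning

fibSum-top-agrees : ∀ {f g} m → NoAdj f → NoAdj g → fibSum 2 f (suc m) ≡ fibSum 2 g (suc m) → f m ≡ g m
fibSum-top-agrees {f} {g} m nf ng eq with f m | g m
... | true  | true  = refl
... | false | false = refl
... | true  | false = ⊥-elim (ℕP.<-irrefl (sym eq) (fibSum-<-top m ng))
... | false | true  = ⊥-elim (ℕP.<-irrefl eq (fibSum-<-top m nf))

fibSum-init-≡ : ∀ {p f g} m → f m ≡ g m → fibSum p f (suc m) ≡ fibSum p g (suc m) → fibSum p f m ≡ fibSum p g m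
fibSum-init-≡ {p} {f} {g} m top eq = ℕP.+-cancelʳ-≡ _ _ _
  (trans eq (cong (λ b → fibSum p g m ℕ.+ (if b then fib (p ℕ.+ m) else 0)) (sym top)))

zeckendorf-unique-below : ∀ {f g} m → NoAdj f → NoAdj g → fibSum 2 f m ≡ fibSum 2 g m → ∀ t → t < m → f t ≡ g t
zeckendorf-unique-below (suc m) nf ng eq t t<1+m with ℕP.m≤n⇒m<n∨m≡n (ℕP.≤-pred t<1+m)
... | inj₁ t<m = zeckendorf-unique-below m nf ng (fibSum-init-≡ m top eq) t t<m
  where top = fibSum-top-agrees m nf ng eq
... | inj₂ refl = fibSum-top-agrees m nf ng eq

zeckendorf-unique : ∀ {f g} M → NoAdj f → NoAdj g → VanishesFrom M f → VanishesFrom M g →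
  fibSum 2 f M ≡ fibSum 2 g M → f ≗ g
zeckendorf-unique M nf ng f0 g0 eq t with t ℕ.<? M
... | yes t<M = zeckendorf-unique-below M nf ng eq t t<M
... | no t≮M = trans (f0 t (ℕP.≮⇒≥ t≮M)) (sym (g0 t (ℕP.≮⇒≥ t≮M)))

true≢false : true ≢ false
true≢false ()

erase : ℕ → (ℕ → Bool) → ℕ → Bool
erase c f t with t ℕ.≟ c
... | yes _ = false
... | no _ = f t

erase-≡ : ∀ c f → erase c f c ≡ false
erase-≡ c f with c ℕ.≟ c
... | yes _ = refl
... | no c≢c = ⊥-elim (c≢c refl)

erase-≢ : ∀ {c t} f → t ≢ c → erase c f t ≡ f t
erase-≢ {c} {t} f t≢c with t ℕ.≟ c
... | yes t≡c = ⊥-elim (t≢c t≡c)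
... | no _ = refl

erase-noAdj : ∀ {c f} → NoAdjExcept c f → NoAdj (erase c f)
erase-noAdj {c} {f} na t e with t ℕ.≟ c
... | yes _ = refl
... | no t≢c with suc t ℕ.≟ c
...   | yes _ = ⊥-elim (true≢false (sym e))
...   | no _ = na t t≢c e

erase-vanishes : ∀ {M c f} → VanishesFrom M f → VanishesFrom M (erase c f)
erase-vanishes {c = c} {f} f0 t M≤t with t ℕ.≟ c
... | yes _ = refl
... | no _ = f0 t M≤t

erase-injective : ∀ {c f g} → erase c f ≗ erase c g → f c ≡ g c → f ≗ g
erase-injective {c} {f} {g} eq fc≡gc t with t ℕ.≟ c
... | yes refl = fc≡gc
... | no t≢c = trans (sym (erase-≢ f t≢c)) (trans (eq t) (erase-≢ g t≢c))

vanishes-< : ∀ {M f c} → VanishesFrom M f → f c ≡ true → c < M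
vanishes-< {M} {f} {c} f0 fc with c ℕ.<? M
... | yes c<M = c<M
... | no c≮M with () ← trans (sym fc) (f0 c (ℕP.≮⇒≥ c≮M))

fibSum-erase : ∀ {c f} m → f c ≡ true → c < m → fibSum 2 f m ≡ fib (2 ℕ.+ c) ℕ.+ fibSum 2 (erase c f) m
fibSum-erase {c} {f} (suc m) fc c<1+m with ℕP.m≤n⇒m<n∨m≡n (ℕP.≤-pred c<1+m)
... | inj₁ c<m = begin
  fibSum 2 f m ℕ.+ top f                              ≡⟨ cong (ℕ._+ top f) (fibSum-erase m fc c<m) ⟩
  fib (2 ℕ.+ c) ℕ.+ fibSum 2 (erase c f) m ℕ.+ top f  ≡⟨ ℕP.+-assoc (fib (2 ℕ.+ c)) _ _ ⟩
  fib (2 ℕ.+ c) ℕ.+ (fibSum 2 (erase c f) m ℕ.+ top f)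
    ≡⟨ cong (λ b → fib (2 ℕ.+ c) ℕ.+ (fibSum 2 (erase c f) m ℕ.+ (if b then fib (2 ℕ.+ m) else 0)))
            (sym (erase-≢ f (λ m≡c → ℕP.<-irrefl (sym m≡c) c<m))) ⟩
  fib (2 ℕ.+ c) ℕ.+ (fibSum 2 (erase c f) m ℕ.+ top (erase c f)) ∎
  where
  open ≡-Reasoning
  top : (ℕ → Bool) → ℕ
  top h = if h m then fib (2 ℕ.+ m) else 0
... | inj₂ refl rewrite fc | erase-≡ c f = begin
  fibSum 2 f c ℕ.+ fib (2 ℕ.+ c)                 ≡⟨ ℕP.+-comm _ (fib (2 ℕ.+ c)) ⟩
  fib (2 ℕ.+ c) ℕ.+ fibSum 2 f c
    ≡⟨ cong (fib (2 ℕ.+ c) ℕ.+_) (fibSum-cong c (λ t t<c → sym (erase-≢ f (ℕP.<⇒≢ t<c)))) ⟩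
  fib (2 ℕ.+ c) ℕ.+ fibSum 2 (erase c f) c       ≡⟨ cong (fib (2 ℕ.+ c) ℕ.+_) (sym (ℕP.+-identityʳ _)) ⟩
  fib (2 ℕ.+ c) ℕ.+ (fibSum 2 (erase c f) c ℕ.+ 0) ∎
  where open ≡-Reasoning

zeckendorf-erase : ∀ {c f g} M → NoAdjExcept c f → f c ≡ true → NoAdj g → VanishesFrom M f → VanishesFrom M g →
  fibSum 2 f M ≡ fib (2 ℕ.+ c) ℕ.+ fibSum 2 g M → erase c f ≗ g
zeckendorf-erase {c} {f} M nf fc ng f0 g0 eq =
  zeckendorf-unique M (erase-noAdj nf) ng (erase-vanishes f0) g0
    (ℕP.+-cancelˡ-≡ (fib (2 ℕ.+ c)) _ _ (trans (sym (fibSum-erase M fc (vanishes-< f0 fc))) eq))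

-- Windows. A window of depth c lists the digits of r from index −c upward; multiplying by φ^(c+2)
-- moves every digit to an index ≥ 2, where the imaginary part of Σ dⱼ φʲ is the sum Σ dⱼ Fⱼ.

lookupℤ-cong : ∀ {xs ys} → flip nth xs ≗ flip nth ys → ∀ i → lookupℤ i xs ≡ lookupℤ i ys
lookupℤ-cong eq (+ n) = eq n
lookupℤ-cong eq -[1+ n ] = refl

lookupℤ-false∷ : ∀ x R → lookupℤ (x + + 1) (false ∷ R) ≡ lookupℤ x R
lookupℤ-false∷ (+ n) R rewrite ℕP.+-comm n 1 = refl
lookupℤ-false∷ -[1+ zero ] R = refl
lookupℤ-false∷ -[1+ suc n ] R = refl

lookupℤ-zeros++ : ∀ d x R → lookupℤ (x + + d) (zeros d ++ R) ≡ lookupℤ x R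
lookupℤ-zeros++ zero x R = cong (flip lookupℤ R) (ℤP.+-identityʳ x)
lookupℤ-zeros++ (suc d) x R = begin
  lookupℤ (x + + suc d) (false ∷ zeros d ++ R)
    ≡⟨ cong (flip lookupℤ (false ∷ zeros d ++ R)) (solve 2 (λ x d → x :+ (con (+ 1) :+ d) := (x :+ d) :+ con (+ 1)) refl x (+ d)) ⟩
  lookupℤ (x + + d + + 1) (false ∷ zeros d ++ R)   ≡⟨ lookupℤ-false∷ (x + + d) (zeros d ++ R) ⟩
  lookupℤ (x + + d) (zeros d ++ R)                 ≡⟨ lookupℤ-zeros++ d x R ⟩
  lookupℤ x R                                      ∎
  where open ≡-Reasoning

record Window (c : ℕ) (r : Rep) : Set where
  field
    bits : List Bool
    digit-bits : ∀ i → digit r i ≡ lookupℤ (i + + c) bits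
    im-value : im (iter (2 ℕ.+ c) mulφ (value r)) ≡ + fibSum 2 (flip nth bits) (length bits)

  bit : ℕ → Bool
  bit = flip nth bits

  bit-vanishes : ∀ {M} → length bits ≤ M → VanishesFrom M bit
  bit-vanishes len≤M t M≤t = nth-vanishes bits t (ℕP.≤-trans len≤M M≤t)

  im-value-≤ : ∀ {M} → length bits ≤ M → im (iter (2 ℕ.+ c) mulφ (value r)) ≡ + fibSum 2 bit M
  im-value-≤ {M} len≤M = trans im-value
    (cong +_ (sym (fibSum-vanishing (nth-vanishes bits) M len≤M)))

  digit-shifted : ∀ t → digit r (+ t - + c) ≡ bit t
  digit-shifted t = trans (digit-bits (+ t - + c))
    (cong (flip lookupℤ bits) (solve 2 (λ t c → (t :- c) :+ c := t) refl (+ t) (+ c)))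

  digit-shifted-suc : ∀ t → digit r ((+ t - + c) + + 1) ≡ bit (suc t)
  digit-shifted-suc t = trans (cong (digit r)
    (solve 2 (λ t c → (t :- c) :+ con (+ 1) := (con (+ 1) :+ t) :- c) refl (+ t) (+ c))) (digit-shifted (suc t))

  noAdj : NoAdj11 r → NoAdj bit
  noAdj na t e = trans (sym (digit-shifted t)) (na (+ t - + c) (trans (digit-shifted-suc t) e))

  noAdjExcept : Special r → NoAdjExcept c bit
  noAdjExcept (_ , _ , na) t t≢c e = trans (sym (digit-shifted t)) (na (+ t - + c) t-c≢0 (trans (digit-shifted-suc t) e))
    where
    t-c≢0 : + t - + c ≢ + 0
    t-c≢0 eq = t≢c (ℤP.+-injective (trans (solve 2 (λ t c → t := (t :- c) :+ c) refl (+ t) (+ c)) (cong (_+ + c) eq)))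

  digit0 : digit r (+ 0) ≡ bit c
  digit0 = digit-bits (+ 0)

  digit1 : digit r (+ 1) ≡ bit (suc c)
  digit1 = digit-bits (+ 1)

windows-agree : ∀ {c r r′} (W : Window c r) (W′ : Window c r′) → Window.bit W ≗ Window.bit W′ →
  ∀ i → digit r i ≡ digit r′ i
windows-agree {c} W W′ eq i =
  trans (Window.digit-bits W i) (trans (lookupℤ-cong eq (i + + c)) (sym (Window.digit-bits W′ i)))

offset-≥0 : ∀ {k c} → ℤ.∣ k ∣ ≤ c → Σ ℕ λ d → k + + c ≡ + d
offset-≥0 {+ a} {c} _ = a ℕ.+ c , refl
offset-≥0 { -[1+ b ]} {c} le = c ℕ.∸ suc b , ℤP.⊖-≥ le

window : ∀ c r → ℤ.∣ proj₁ r ∣ ≤ c → Window c r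
window c (k , ds) le with offset-≥0 {k} le
... | d , k+c≡d = record { bits = zeros d ++ ds ; digit-bits = digit-bits ; im-value = im-value }
  where
  open ≡-Reasoning
  digit-bits : ∀ i → lookupℤ (i - k) ds ≡ lookupℤ (i + + c) (zeros d ++ ds)
  digit-bits i = begin
    lookupℤ (i - k) ds                            ≡⟨ sym (lookupℤ-zeros++ d (i - k) ds) ⟩
    lookupℤ ((i - k) + + d) (zeros d ++ ds)       ≡⟨ cong (λ j → lookupℤ ((i - k) + j) (zeros d ++ ds)) (sym k+c≡d) ⟩
    lookupℤ ((i - k) + (k + + c)) (zeros d ++ ds)
      ≡⟨ cong (flip lookupℤ (zeros d ++ ds)) (solve 3 (λ i k c → (i :- k) :+ (k :+ c) := i :+ c) refl i k (+ c)) ⟩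
    lookupℤ (i + + c) (zeros d ++ ds)             ∎
  im-value : im (iter (2 ℕ.+ c) mulφ (valueFrom k ds)) ≡ + fibSum 2 (flip nth (zeros d ++ ds)) (length (zeros d ++ ds))
  im-value = begin
    im (iter (2 ℕ.+ c) mulφ (valueFrom k ds))
      ≡⟨ cong (λ j → im (iter (2 ℕ.+ c) mulφ (valueFrom j ds))) (solve 2 (λ k c → k := (:- c) :+ (k :+ c)) refl k (+ c)) ⟩
    im (iter (2 ℕ.+ c) mulφ (valueFrom (- + c + (k + + c)) ds))
      ≡⟨ cong (λ j → im (iter (2 ℕ.+ c) mulφ (valueFrom (- + c + j) ds))) k+c≡d ⟩
    im (iter (2 ℕ.+ c) mulφ (valueFrom (- + c + + d) ds))
      ≡⟨ cong (λ x → im (iter (2 ℕ.+ c) mulφ x)) (sym (valueFrom-zeros++ d (- + c) ds)) ⟩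
    im (iter (2 ℕ.+ c) mulφ (valueFrom (- + c) (zeros d ++ ds)))
      ≡⟨ cong im (valueFrom-iter-mulφ (2 ℕ.+ c) (- + c) (zeros d ++ ds)) ⟩
    im (valueFrom (- + c + + (2 ℕ.+ c)) (zeros d ++ ds))
      ≡⟨ cong (λ j → im (valueFrom j (zeros d ++ ds))) (solve 1 (λ c → (:- c) :+ (con (+ 2) :+ c) := con (+ 2)) refl (+ c)) ⟩
    im (valueFrom (+ 2) (zeros d ++ ds))
      ≡⟨ im-valueFrom 2 (zeros d ++ ds) ⟩
    + fibSum 2 (flip nth (zeros d ++ ds)) (length (zeros d ++ ds)) ∎

module CommonWindow (r r′ : Rep) where
  c : ℕ
  c = ℤ.∣ proj₁ r ∣ ℕ.+ ℤ.∣ proj₁ r′ ∣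

  W : Window c r
  W = window c r (ℕP.m≤m+n ℤ.∣ proj₁ r ∣ ℤ.∣ proj₁ r′ ∣)

  W′ : Window c r′
  W′ = window c r′ (ℕP.m≤n+m ℤ.∣ proj₁ r′ ∣ ℤ.∣ proj₁ r ∣)

  f g : ℕ → Bool
  f = Window.bit W
  g = Window.bit W′

  ℓ ℓ′ M : ℕ
  ℓ = length (Window.bits W)
  ℓ′ = length (Window.bits W′)
  M = ℓ ℕ.+ ℓ′

  f-vanishes : VanishesFrom M f
  f-vanishes = Window.bit-vanishes W (ℕP.m≤m+n ℓ ℓ′)

  g-vanishes : VanishesFrom M g
  g-vanishes = Window.bit-vanishes W′ (ℕP.m≤n+m ℓ′ ℓ)

  im-f : im (iter (2 ℕ.+ c) mulφ (value r)) ≡ + fibSum 2 f M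
  im-f = Window.im-value-≤ W (ℕP.m≤m+n ℓ ℓ′)

  im-g : im (iter (2 ℕ.+ c) mulφ (value r′)) ≡ + fibSum 2 g M
  im-g = Window.im-value-≤ W′ (ℕP.m≤n+m ℓ′ ℓ)

  fibSum-≡ : value r ≡ value r′ → fibSum 2 f M ≡ fibSum 2 g M
  fibSum-≡ v = ℤP.+-injective (trans (sym im-f) (trans (cong (λ x → im (iter (2 ℕ.+ c) mulφ x)) v) im-g))

  fibSum-≡-erase-g : value r ≡ value r′ → g c ≡ true → fibSum 2 f M ≡ fib (2 ℕ.+ c) ℕ.+ fibSum 2 (erase c g) M
  fibSum-≡-erase-g v gc = trans (fibSum-≡ v) (fibSum-erase M gc (vanishes-< g-vanishes gc))

bergman-unique : ∀ {r r′} → NoAdj11 r → NoAdj11 r′ → value r ≡ value r′ → ∀ i → digit r i ≡ digit r′ i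
bergman-unique {r} {r′} na na′ v = windows-agree W W′
  (zeckendorf-unique M (Window.noAdj W na) (Window.noAdj W′ na′) f-vanishes g-vanishes (fibSum-≡ v))
  where open CommonWindow r r′

special-unique : ∀ {r r′} → Special r → Special r′ → value r ≡ value r′ → ∀ i → digit r i ≡ digit r′ i
special-unique {r} {r′} sp@(_ , r₀ , _) sp′@(_ , r′₀ , _) v = windows-agree W W′ (erase-injective
  (zeckendorf-erase M (Window.noAdjExcept W sp) fc (erase-noAdj (Window.noAdjExcept W′ sp′))
    f-vanishes (erase-vanishes g-vanishes) (fibSum-≡-erase-g v gc))
  (trans fc (sym gc)))
  where
  open CommonWindow r r′
  fc : f c ≡ true
  fc = trans (sym (Window.digit0 W)) r₀
  gc : g c ≡ true
  gc = trans (sym (Window.digit0 W′)) r′₀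

special-pred-digit1 : ∀ {s e} → Special s → NoAdj11 e → value s ≡ oneφ +φ value e → digit e (+ 1) ≡ true
special-pred-digit1 {s} {e} sp@(s₁ , s₀ , _) na v = begin
  digit e (+ 1)      ≡⟨ Window.digit1 W′ ⟩
  g (suc c)          ≡⟨ sym (erased (suc c)) ⟩
  erase c f (suc c)  ≡⟨ erase-≢ f (ℕP.1+n≢n {c}) ⟩
  f (suc c)          ≡⟨ sym (Window.digit1 W) ⟩
  digit s (+ 1)      ≡⟨ s₁ ⟩
  true               ∎
  where
  open CommonWindow s e
  open ≡-Reasoning
  fc : f c ≡ true
  fc = trans (sym (Window.digit0 W)) s₀
  im-sum : + fibSum 2 f M ≡ + fib (2 ℕ.+ c) + + fibSum 2 g M
  im-sum = begin
    + fibSum 2 f M                                            ≡⟨ sym im-f ⟩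
    im (iter (2 ℕ.+ c) mulφ (value s))                        ≡⟨ cong (λ x → im (iter (2 ℕ.+ c) mulφ x)) v ⟩
    im (iter (2 ℕ.+ c) mulφ (oneφ +φ value e))                ≡⟨ cong im (iter-mulφ-+φ (2 ℕ.+ c) oneφ (value e)) ⟩
    im (φ^ (+ (2 ℕ.+ c))) + im (iter (2 ℕ.+ c) mulφ (value e)) ≡⟨ cong₂ _+_ (im-φ^ (2 ℕ.+ c)) im-g ⟩
    + fib (2 ℕ.+ c) + + fibSum 2 g M                          ∎
  erased : erase c f ≗ g
  erased = zeckendorf-erase M (Window.noAdjExcept W sp) fc (Window.noAdj W′ na) f-vanishes g-vanishes
    (ℤP.+-injective im-sum)

special-bergman-digit1 : ∀ {s e} → Special s → NoAdj11 e → value s ≡ value e → digit e (+ 0) ≡ true →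
  digit e (+ 1) ≡ true
special-bergman-digit1 {s} {e} sp@(s₁ , s₀ , _) na v e₀ = begin
  digit e (+ 1)      ≡⟨ Window.digit1 W′ ⟩
  g (suc c)          ≡⟨ sym (erase-≢ g (ℕP.1+n≢n {c})) ⟩
  erase c g (suc c)  ≡⟨ sym (erased (suc c)) ⟩
  erase c f (suc c)  ≡⟨ erase-≢ f (ℕP.1+n≢n {c}) ⟩
  f (suc c)          ≡⟨ sym (Window.digit1 W) ⟩
  digit s (+ 1)      ≡⟨ s₁ ⟩
  true               ∎
  where
  open CommonWindow s e
  open ≡-Reasoning
  fc : f c ≡ true
  fc = trans (sym (Window.digit0 W)) s₀
  gc : g c ≡ true
  gc = trans (sym (Window.digit0 W′)) e₀
  erased : erase c f ≗ erase c g
  erased = zeckendorf-erase M (Window.noAdjExcept W sp) fc (erase-noAdj (λ t _ → Window.noAdj W′ na t))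
    f-vanishes (erase-vanishes g-vanishes) (fibSum-≡-erase-g v gc)

HasSpecial : ℕ → Set
HasSpecial N = Σ Rep λ s → Represents N s × Special s

canonical-special : ∀ {N s r} → Represents N s → Special s → IsCanonical N r → ∀ i → digit r i ≡ digit s i
canonical-special rep sp (inj₁ (rep′ , sp′)) = special-unique sp′ sp (trans rep′ (sym rep))
canonical-special rep sp (inj₂ (none , _)) = ⊥-elim (none (_ , rep , sp))

canonical-bergman : ∀ {N e r} → ¬ HasSpecial N → IsBergman N e → IsCanonical N r → ∀ i → digit r i ≡ digit e i
canonical-bergman none _ (inj₁ (rep , sp)) = ⊥-elim (none (_ , rep , sp))
canonical-bergman none (rep , na) (inj₂ (_ , rep′ , na′)) = bergman-unique na′ na (trans rep′ (sym rep))

no-special-+1 : ∀ {N e} → IsBergman N e → digit e (+ 1) ≡ false → ¬ HasSpecial (N ℕ.+ 1)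
no-special-+1 {N} {e} (rep , na) e₁ (s , rep′ , sp) =
  true≢false (trans (sym (special-pred-digit1 sp na v)) e₁)
  where
  v : value s ≡ oneφ +φ value e
  v = trans rep′ (trans (embed-+1 N) (cong (oneφ +φ_) (sym rep)))

no-special-10 : ∀ {N e} → IsBergman N e → digit e (+ 0) ≡ true → digit e (+ 1) ≡ false → ¬ HasSpecial N
no-special-10 (rep , na) e₀ e₁ (s , rep′ , sp) =
  true≢false (trans (sym (special-bergman-digit1 sp na (trans rep′ (sym rep)) e₀)) e₁)

noAdj-false∷ : ∀ {R} → NoAdj (flip nth R) → NoAdj (flip nth (false ∷ R))
noAdj-false∷ na zero _ = refl
noAdj-false∷ na (suc t) e = na t e

noAdj-true∷ : ∀ {R} → NoAdj (flip nth R) → nth 0 R ≡ false → NoAdj (flip nth (true ∷ R))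
noAdj-true∷ na R₀ zero e = ⊥-elim (true≢false (trans (sym e) R₀))
noAdj-true∷ na R₀ (suc t) e = na t e

noAdj-[true] : NoAdj (flip nth (true ∷ []))
noAdj-[true] t ()

noAdj-zeros++ : ∀ d {R} → NoAdj (flip nth R) → NoAdj (flip nth (zeros d ++ R))
noAdj-zeros++ zero na = na
noAdj-zeros++ (suc d) na = noAdj-false∷ (noAdj-zeros++ d na)

noAdj-alternating++ : ∀ m {R} → NoAdj (flip nth R) → NoAdj (flip nth (alternating m ++ R))
noAdj-alternating++ zero na = na
noAdj-alternating++ (suc m) na = noAdj-true∷ (noAdj-false∷ (noAdj-alternating++ m na)) refl

noAdjExcept-zeros++ : ∀ d {c R} → NoAdjExcept c (flip nth R) → NoAdjExcept (d ℕ.+ c) (flip nth (zeros d ++ R))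
noAdjExcept-zeros++ zero na = na
noAdjExcept-zeros++ (suc d) na zero _ _ = refl
noAdjExcept-zeros++ (suc d) na (suc t) t≢c e = noAdjExcept-zeros++ d na t (t≢c ∘ cong suc) e

noAdjExcept-true∷ : ∀ {c R} → NoAdjExcept c (flip nth R) → nth 0 R ≡ false → NoAdjExcept (suc c) (flip nth (true ∷ R))
noAdjExcept-true∷ na R₀ zero _ e = ⊥-elim (true≢false (trans (sym e) R₀))
noAdjExcept-true∷ na R₀ (suc t) t≢c e = na t (t≢c ∘ cong suc) e

noAdj-alternating : ∀ m → NoAdj (flip nth (alternating m))
noAdj-alternating zero _ ()
noAdj-alternating (suc m) = noAdj-true∷ (noAdj-false∷ (noAdj-alternating m)) refl

noAdjExcept-0-true∷ : ∀ {R} → NoAdj (flip nth R) → NoAdjExcept 0 (flip nth (true ∷ R))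
noAdjExcept-0-true∷ na zero 0≢0 = ⊥-elim (0≢0 refl)
noAdjExcept-0-true∷ na (suc t) _ = na t

index-suc : ∀ {i k t} → i - k ≡ + t → (i + + 1) - k ≡ + suc t
index-suc {i} {k} eq =
  trans (solve 2 (λ i k → (i :+ con (+ 1)) :- k := con (+ 1) :+ (i :- k)) refl i k) (cong (λ j → + 1 + j) eq)

noAdj11-at : ∀ k ds → NoAdj (flip nth ds) → NoAdj11 (k , ds)
noAdj11-at k ds na i e with i - k in i-k
... | + t = na t (trans (cong (flip lookupℤ ds) (sym (index-suc {i} {k} i-k))) e)
... | -[1+ _ ] = refl

special-at : ∀ c ds → NoAdjExcept c (flip nth ds) → nth c ds ≡ true → nth (suc c) ds ≡ true → Special (- + c , ds)
special-at c ds na d₀ d₁ = subst (λ j → lookupℤ j ds ≡ true) (sym (j+c (+ 1))) d₁ ,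
                            subst (λ j → lookupℤ j ds ≡ true) (sym (j+c (+ 0))) d₀ , na′
  where
  j+c : ∀ j → j - - + c ≡ j + + c
  j+c j = cong (_+_ j) (ℤP.neg-involutive (+ c))
  na′ : ∀ i → i ≢ + 0 → digit (- + c , ds) (i + + 1) ≡ true → digit (- + c , ds) i ≡ false
  na′ i i≢0 e with i - - + c in i+c
  ... | + t = na t t≢c (trans (cong (flip lookupℤ ds) (sym (index-suc {i} { - + c} i+c))) e)
    where
    t≢c : t ≢ c
    t≢c refl = i≢0 (begin
      i                ≡⟨ solve 2 (λ i c → i := (i :+ c) :- c) refl i (+ t) ⟩
      (i + + t) - + t  ≡⟨ cong (_- + t) (trans (sym (j+c i)) i+c) ⟩
      + t - + t        ≡⟨ ℤP.+-inverseʳ (+ t) ⟩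
      + 0              ∎)
      where open ≡-Reasoning
  ... | -[1+ _ ] = refl

nth-zeros++ : ∀ d u R → nth (d ℕ.+ u) (zeros d ++ R) ≡ nth u R
nth-zeros++ zero u R = refl
nth-zeros++ (suc d) u R = nth-zeros++ d u R

nth-zeros++-true : ∀ d t R → nth t (zeros d ++ R) ≡ true → Σ ℕ λ u → t ≡ d ℕ.+ u × nth u R ≡ true
nth-zeros++-true zero t R e = t , refl , e
nth-zeros++-true (suc d) (suc t) R e with nth-zeros++-true d t R e
... | u , refl , e′ = u , refl , e′

nth-alternating++-true : ∀ m u R → nth u (alternating m ++ R) ≡ true →
  (Σ ℕ λ j → j < m × u ≡ j ℕ.+ j) ⊎ (Σ ℕ λ v → u ≡ (m ℕ.+ m) ℕ.+ v × nth v R ≡ true)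
nth-alternating++-true zero u R e = inj₂ (u , refl , e)
nth-alternating++-true (suc m) zero R e = inj₁ (0 , s≤s z≤n , refl)
nth-alternating++-true (suc m) (suc (suc u)) R e with nth-alternating++-true m u R e
... | inj₁ (j , j<m , refl) = inj₁ (suc j , s≤s j<m , cong suc (sym (ℕP.+-suc j j)))
... | inj₂ (v , refl , e′) = inj₂ (v , cong suc (cong (ℕ._+ v) (sym (ℕP.+-suc m m))) , e′)

nth-alternating++-even : ∀ m j R → j < m → nth (j ℕ.+ j) (alternating m ++ R) ≡ true
nth-alternating++-even (suc m) zero R _ = refl
nth-alternating++-even (suc m) (suc j) R (s≤s j<m) rewrite ℕP.+-suc j j = nth-alternating++-even m j R j<m

nth-alternating++-odd : ∀ m j R → j < m → nth (suc (j ℕ.+ j)) (alternating m ++ R) ≡ false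
nth-alternating++-odd (suc m) zero R _ = refl
nth-alternating++-odd (suc m) (suc j) R (s≤s j<m) rewrite ℕP.+-suc j j = nth-alternating++-odd m j R j<m

nth-alternating-odd : ∀ m j → nth (suc (j ℕ.+ j)) (alternating m) ≡ false
nth-alternating-odd zero j = refl
nth-alternating-odd (suc m) zero = refl
nth-alternating-odd (suc m) (suc j) rewrite ℕP.+-suc j j = nth-alternating-odd m j

-- Representations of L(a), L(a)+1, L(a+1), L(a+1)+1 for a = 2n ≥ 2

module LucasDigits (p : ℕ) where
  n a′ a : ℕ
  n = suc p
  a′ = p ℕ.+ n
  a = n ℕ.+ n

  k k′ : ℤ
  k = - + a
  k′ = - + suc (suc a)

  -- Read from k = −a (bergman-odd+1 from k′ = −a−2), these strings are
  --   bergman-even   : L(a)       = φ⁻ᵃ + φᵃ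
  --   special-even   : L(a)       = φ⁻ᵃ + φ⁰ + φ¹ + φ³ + … + φᵃ⁻¹
  --   bergman-even+1 : L(a) + 1   = φ⁻ᵃ + φ⁰ + φᵃ
  --   bergman-odd    : L(a+1)     = φ⁻ᵃ + φ⁻ᵃ⁺² + … + φᵃ⁻² + φᵃ
  --   bergman-odd+1  : L(a+1) + 1 = φ⁻ᵃ⁻² + φ⁻ᵃ⁺¹ + φ⁻ᵃ⁺³ + … + φ⁻¹ + φᵃ⁺¹
  bergman-even bergman-even+1 special-even bergman-odd bergman-odd+1 : List Bool
  bergman-even   = true ∷ zeros a′ ++ false ∷ zeros a′ ++ true ∷ []
  bergman-even+1 = true ∷ zeros a′ ++ true ∷ zeros a′ ++ true ∷ []
  special-even   = true ∷ zeros a′ ++ true ∷ alternating n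
  bergman-odd    = alternating a ++ true ∷ []
  bergman-odd+1  = true ∷ false ∷ false ∷ alternating n ++ zeros a ++ true ∷ []

  private
    A : ℤ
    A = + a

    k+a≡0 : k + A ≡ + 0
    k+a≡0 = ℤP.+-inverseˡ A

    k+a+a≡a : k + A + A ≡ A
    k+a+a≡a = solve 1 (λ A → (:- A) :+ A :+ A := A) refl A

  value-bergman-even : valueFrom k bergman-even ≡ φ^ (+ a) +φ φ^ k
  value-bergman-even = begin
    valueFrom k bergman-even                          ≡⟨ valueFrom-true∷zeros++ k a′ _ ⟩
    φ^ k +φ valueFrom (k + A) (zeros a ++ true ∷ [])   ≡⟨ cong (φ^ k +φ_) (valueFrom-zeros++ a (k + A) _) ⟩
    φ^ k +φ (φ^ (k + A + A) +φ zeroφ)                  ≡⟨ cong (λ j → φ^ k +φ (φ^ j +φ zeroφ)) k+a+a≡a ⟩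
    φ^ k +φ (φ^ A +φ zeroφ)                            ≡⟨ cong (φ^ k +φ_) (+φ-identityʳ (φ^ A)) ⟩
    φ^ k +φ φ^ A                                       ≡⟨ +φ-comm (φ^ k) (φ^ A) ⟩
    φ^ A +φ φ^ k                                       ∎
    where open ≡-Reasoning

  value-bergman-even+1 : valueFrom k bergman-even+1 ≡ oneφ +φ (φ^ (+ a) +φ φ^ k)
  value-bergman-even+1 = begin
    valueFrom k bergman-even+1                                  ≡⟨ valueFrom-true∷zeros++ k a′ _ ⟩
    φ^ k +φ valueFrom (k + A) (true ∷ zeros a′ ++ true ∷ [])
      ≡⟨ cong (φ^ k +φ_) (valueFrom-true∷zeros++ (k + A) a′ _) ⟩
    φ^ k +φ (φ^ (k + A) +φ (φ^ (k + A + A) +φ zeroφ))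
      ≡⟨ cong₂ (λ i j → φ^ k +φ (φ^ i +φ (φ^ j +φ zeroφ))) k+a≡0 k+a+a≡a ⟩
    φ^ k +φ (oneφ +φ (φ^ A +φ zeroφ))                         ≡⟨ cong (λ x → φ^ k +φ (oneφ +φ x)) (+φ-identityʳ (φ^ A)) ⟩
    φ^ k +φ (oneφ +φ φ^ A)                                    ≡⟨ +φ-comm (φ^ k) _ ⟩
    (oneφ +φ φ^ A) +φ φ^ k                                    ≡⟨ +φ-assoc oneφ (φ^ A) (φ^ k) ⟩
    oneφ +φ (φ^ A +φ φ^ k)                                    ∎
    where open ≡-Reasoning

  value-special-even : valueFrom k special-even ≡ φ^ (+ a) +φ φ^ k
  value-special-even = begin
    valueFrom k special-even                                  ≡⟨ valueFrom-true∷zeros++ k a′ _ ⟩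
    φ^ k +φ (φ^ (k + A) +φ valueFrom (k + A + + 1) (alternating n))
      ≡⟨ cong (φ^ k +φ_) (φ^-+-valueFrom-alternating n (k + A)) ⟩
    φ^ k +φ φ^ (k + A + + n + + n)
      ≡⟨ cong (λ j → φ^ k +φ φ^ j) (solve 1 (λ N → (:- (N :+ N)) :+ (N :+ N) :+ N :+ N := N :+ N) refl (+ n)) ⟩
    φ^ k +φ φ^ A                                              ≡⟨ +φ-comm (φ^ k) (φ^ A) ⟩
    φ^ A +φ φ^ k                                              ∎
    where open ≡-Reasoning

  value-bergman-odd : φ^ (- + suc a) +φ valueFrom k bergman-odd ≡ φ^ (+ suc a)
  value-bergman-odd = begin
    φ^ (- + suc a) +φ valueFrom k (alternating a ++ true ∷ [])
      ≡⟨ cong (φ^ (- + suc a) +φ_) (valueFrom-++ k (alternating a) (true ∷ [])) ⟩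
    φ^ (- + suc a) +φ (valueFrom k (alternating a) +φ (φ^ (k + + length (alternating a)) +φ zeroφ))
      ≡⟨ sym (+φ-assoc (φ^ (- + suc a)) _ _) ⟩
    (φ^ (- + suc a) +φ valueFrom k (alternating a)) +φ (φ^ (k + + length (alternating a)) +φ zeroφ)
      ≡⟨ cong₂ _+φ_ lower upper ⟩
    φ^ j +φ φ^ (j + + 1)       ≡⟨ φ^-golden j ⟩
    φ^ (j + + 2)
      ≡⟨ cong φ^ (solve 1 (λ A → (:- (con (+ 1) :+ A)) :+ A :+ A :+ con (+ 2) := con (+ 1) :+ A) refl A) ⟩
    φ^ (+ suc a)               ∎
    where
    open ≡-Reasoning
    j = - + suc a + A + A
    lower : φ^ (- + suc a) +φ valueFrom k (alternating a) ≡ φ^ j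
    lower = trans (cong (λ i → φ^ (- + suc a) +φ valueFrom i (alternating a))
                    (solve 1 (λ A → :- A := (:- (con (+ 1) :+ A)) :+ con (+ 1)) refl A))
                  (φ^-+-valueFrom-alternating a (- + suc a))
    upper : φ^ (k + + length (alternating a)) +φ zeroφ ≡ φ^ (j + + 1)
    upper = trans (+φ-identityʳ _) (cong φ^ (trans (cong (λ l → k + + l) (length-alternating a))
              (solve 1 (λ A → (:- A) :+ (A :+ A) := (:- (con (+ 1) :+ A)) :+ A :+ A :+ con (+ 1)) refl A)))

  value-bergman-odd+1 : φ^ k +φ valueFrom k′ bergman-odd+1 ≡ φ^ k′ +φ (oneφ +φ φ^ (+ suc a))
  value-bergman-odd+1 = begin
    φ^ k +φ (φ^ k′ +φ valueFrom (k′ + + 1 + + 1 + + 1) (alternating n ++ zeros a ++ true ∷ []))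
      ≡⟨ cong (λ i → φ^ k +φ (φ^ k′ +φ valueFrom i (alternating n ++ zeros a ++ true ∷ [])))
              (solve 1 (λ A → (:- (con (+ 2) :+ A)) :+ con (+ 1) :+ con (+ 1) :+ con (+ 1) := (:- A) :+ con (+ 1)) refl A) ⟩
    φ^ k +φ (φ^ k′ +φ valueFrom (k + + 1) (alternating n ++ zeros a ++ true ∷ []))
      ≡⟨ cong (λ x → φ^ k +φ (φ^ k′ +φ x)) (valueFrom-++ (k + + 1) (alternating n) _) ⟩
    φ^ k +φ (φ^ k′ +φ (valueFrom (k + + 1) (alternating n) +φ valueFrom j (zeros a ++ true ∷ [])))
      ≡⟨ shuffle (φ^ k) (φ^ k′) _ _ ⟩
    φ^ k′ +φ ((φ^ k +φ valueFrom (k + + 1) (alternating n)) +φ valueFrom j (zeros a ++ true ∷ []))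
      ≡⟨ cong (λ x → φ^ k′ +φ x) (cong₂ _+φ_ lower upper) ⟩
    φ^ k′ +φ (oneφ +φ φ^ (+ suc a))
      ∎
    where
    open ≡-Reasoning
    j = k + + 1 + + length (alternating n)
    shuffle : ∀ x y w z → x +φ (y +φ (w +φ z)) ≡ y +φ ((x +φ w) +φ z)
    shuffle (a ⊕ b φ) (c ⊕ d φ) (e ⊕ f φ) (g ⊕ h φ) = cong₂ _⊕_φ (ℤ-shuffle a c e g) (ℤ-shuffle b d f h)
      where ℤ-shuffle = solve 4 (λ a c e g → a :+ (c :+ (e :+ g)) := c :+ ((a :+ e) :+ g)) refl
    lower : φ^ k +φ valueFrom (k + + 1) (alternating n) ≡ oneφ
    lower = trans (φ^-+-valueFrom-alternating n k) (cong φ^ (solve 1 (λ N → (:- (N :+ N)) :+ N :+ N := con (+ 0)) refl (+ n)))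
    upper : valueFrom j (zeros a ++ true ∷ []) ≡ φ^ (+ suc a)
    upper = trans (valueFrom-zeros++ a j _) (trans (+φ-identityʳ _) (cong φ^
              (trans (cong (λ l → k + + 1 + + l + A) (length-alternating n))
                     (solve 1 (λ A → (:- A) :+ con (+ 1) :+ A :+ A := con (+ 1) :+ A) refl A))))

  private
    head-zeros : ∀ R → nth 0 (zeros a′ ++ R) ≡ false
    head-zeros R rewrite ℕP.+-suc p p = refl

    nth-after-zeros : ∀ {R} → nth a′ (zeros a′ ++ R) ≡ nth 0 R
    nth-after-zeros {R} = subst (λ u → nth u (zeros a′ ++ R) ≡ nth 0 R) (ℕP.+-identityʳ a′) (nth-zeros++ a′ 0 R)

    nth-after-zeros-suc : ∀ {R} → nth (suc a′) (zeros a′ ++ R) ≡ nth 1 R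
    nth-after-zeros-suc {R} = subst (λ u → nth u (zeros a′ ++ R) ≡ nth 1 R) (ℕP.+-comm a′ 1) (nth-zeros++ a′ 1 R)

    n<a : n < a
    n<a = ℕP.m<m+n n (s≤s z≤n)

  is-bergman-even : IsBergman (L a) (k , bergman-even)
  is-bergman-even = trans value-bergman-even (sym (Lucas-even n)) ,
    noAdj11-at k _ (noAdj-true∷ (noAdj-zeros++ a′ (noAdj-false∷ (noAdj-zeros++ a′ noAdj-[true]))) (head-zeros _))

  bergman-even-digit1 : digit (k , bergman-even) (+ 1) ≡ false
  bergman-even-digit1 = trans nth-after-zeros-suc (head-zeros _)

  is-bergman-even+1 : IsBergman (L a ℕ.+ 1) (k , bergman-even+1)
  is-bergman-even+1 = trans value-bergman-even+1 (trans (cong (oneφ +φ_) (sym (Lucas-even n))) (sym (embed-+1 (L a)))) ,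
    noAdj11-at k _ (noAdj-true∷ (noAdj-zeros++ a′ (noAdj-true∷ (noAdj-zeros++ a′ noAdj-[true]) (head-zeros _))) (head-zeros _))

  represents-special-even : Represents (L a) (k , special-even)
  represents-special-even = trans value-special-even (sym (Lucas-even n))

  is-special-even : Special (k , special-even)
  is-special-even = special-at a special-even
    (noAdjExcept-true∷ (subst (λ c → NoAdjExcept c (flip nth (zeros a′ ++ true ∷ alternating n))) (ℕP.+-identityʳ a′)
       (noAdjExcept-zeros++ a′ (noAdjExcept-0-true∷ (noAdj-alternating n)))) (head-zeros _))
    nth-after-zeros nth-after-zeros-suc

  is-bergman-odd : IsBergman (L (suc a)) (k , bergman-odd)
  is-bergman-odd = +φ-cancelˡ (φ^ (- + suc a))
      (trans value-bergman-odd (trans (sym (Lucas-odd n)) (+φ-comm (embed (L (suc a))) (φ^ (- + suc a))))) ,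
    noAdj11-at k _ (noAdj-alternating++ a noAdj-[true])

  bergman-odd-digit0 : digit (k , bergman-odd) (+ 0) ≡ true
  bergman-odd-digit0 = nth-alternating++-even a n (true ∷ []) n<a

  bergman-odd-digit1 : digit (k , bergman-odd) (+ 1) ≡ false
  bergman-odd-digit1 = nth-alternating++-odd a n (true ∷ []) n<a

  is-bergman-odd+1 : IsBergman (L (suc a) ℕ.+ 1) (k′ , bergman-odd+1)
  is-bergman-odd+1 = +φ-cancelˡ (φ^ k) (trans value-bergman-odd+1 (sym value-target)) ,
    noAdj11-at k′ _ (noAdj-true∷ (noAdj-false∷ (noAdj-false∷ (noAdj-alternating++ n (noAdj-zeros++ a noAdj-[true])))) refl)
    where
    open ≡-Reasoning
    φ^k : φ^ k ≡ φ^ k′ +φ φ^ (- + suc a)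
    φ^k = sym (trans (φ^-golden k′) (cong φ^ (solve 1 (λ A → (:- (con (+ 2) :+ A)) :+ con (+ 2) := :- A) refl A)))
    shuffle : ∀ x y w z → (x +φ y) +φ (w +φ z) ≡ x +φ (w +φ (z +φ y))
    shuffle (a ⊕ b φ) (c ⊕ d φ) (e ⊕ f φ) (g ⊕ h φ) = cong₂ _⊕_φ (ℤ-shuffle a c e g) (ℤ-shuffle b d f h)
      where ℤ-shuffle = solve 4 (λ a c e g → (a :+ c) :+ (e :+ g) := a :+ (e :+ (g :+ c))) refl
    value-target : φ^ k +φ embed (L (suc a) ℕ.+ 1) ≡ φ^ k′ +φ (oneφ +φ φ^ (+ suc a))
    value-target = begin
      φ^ k +φ embed (L (suc a) ℕ.+ 1)
        ≡⟨ cong₂ _+φ_ φ^k (embed-+1 (L (suc a))) ⟩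
      (φ^ k′ +φ φ^ (- + suc a)) +φ (oneφ +φ embed (L (suc a)))
        ≡⟨ shuffle (φ^ k′) (φ^ (- + suc a)) oneφ (embed (L (suc a))) ⟩
      φ^ k′ +φ (oneφ +φ (embed (L (suc a)) +φ φ^ (- + suc a)))
        ≡⟨ cong (λ x → φ^ k′ +φ (oneφ +φ x)) (Lucas-odd n) ⟩
      φ^ k′ +φ (oneφ +φ φ^ (+ suc a)) ∎

  ones-bergman-even+1 : ∀ t → nth t bergman-even+1 ≡ true → t ≡ 0 ⊎ t ≡ a ⊎ t ≡ a ℕ.+ a
  ones-bergman-even+1 zero _ = inj₁ refl
  ones-bergman-even+1 (suc t) e with nth-zeros++-true a′ t _ e
  ... | zero , refl , _ = inj₂ (inj₁ (cong suc (ℕP.+-identityʳ a′)))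
  ... | suc u , refl , e′ with nth-zeros++-true a′ u _ e′
  ...   | zero , refl , _ = inj₂ (inj₂ (cong (λ x → suc (a′ ℕ.+ suc x)) (ℕP.+-identityʳ a′)))
  ...   | suc v , refl , ()

  special-even-a+a : nth (a ℕ.+ a) special-even ≡ false
  special-even-a+a = trans (nth-zeros++ a′ a _)
    (subst (λ x → nth x (alternating n) ≡ false) (sym (ℕP.+-suc p p)) (nth-alternating-odd n p))

  common-ones-even : ∀ i → (digit (k , special-even) i ≡ true × digit (k , bergman-even+1) i ≡ true) ⇔ (i ≡ + 0 ⊎ i ≡ k)
  common-ones-even i = mk⇔ to from
    where
    i≡ : ∀ {t} → i - k ≡ + t → i ≡ + t + k
    i≡ {t} i-k = trans (solve 2 (λ i k → i := (i :- k) :+ k) refl i k) (cong (_+ k) i-k)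
    to : digit (k , special-even) i ≡ true × digit (k , bergman-even+1) i ≡ true → i ≡ + 0 ⊎ i ≡ k
    to (γ , β) with i - k in i-k
    ... | -[1+ _ ] = ⊥-elim (true≢false (sym β))
    ... | + t with ones-bergman-even+1 t β
    ...   | inj₁ refl = inj₂ (trans (i≡ i-k) (ℤP.+-identityˡ k))
    ...   | inj₂ (inj₁ refl) = inj₁ (trans (i≡ i-k) (ℤP.+-inverseʳ (+ a)))
    ...   | inj₂ (inj₂ refl) = ⊥-elim (true≢false (trans (sym γ) special-even-a+a))
    from : i ≡ + 0 ⊎ i ≡ k → digit (k , special-even) i ≡ true × digit (k , bergman-even+1) i ≡ true
    from (inj₁ refl) = nth-after-zeros , nth-after-zeros
    from (inj₂ refl) = subst (λ j → lookupℤ j special-even ≡ true) (sym (ℤP.+-inverseʳ k)) refl ,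
                       subst (λ j → lookupℤ j bergman-even+1 ≡ true) (sym (ℤP.+-inverseʳ k)) refl

  ones-bergman-odd+1 : ∀ u → nth u bergman-odd+1 ≡ true →
    u ≡ 0 ⊎ (Σ ℕ λ j → j < n × u ≡ 3 ℕ.+ (j ℕ.+ j)) ⊎ u ≡ 3 ℕ.+ (a ℕ.+ a)
  ones-bergman-odd+1 zero _ = inj₁ refl
  ones-bergman-odd+1 (suc (suc (suc u))) e with nth-alternating++-true n u _ e
  ... | inj₁ (j , j<n , refl) = inj₂ (inj₁ (j , j<n , refl))
  ... | inj₂ (v , refl , e′) with nth-zeros++-true a v _ e′
  ...   | zero , refl , _ = inj₂ (inj₂ (cong (λ x → 3 ℕ.+ (a ℕ.+ x)) (ℕP.+-identityʳ a)))
  ...   | suc w , refl , ()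

  no-common-ones-odd : ∀ i → ¬ (digit (k , bergman-odd) i ≡ true × digit (k′ , bergman-odd+1) i ≡ true)
  no-common-ones-odd i (δ , ε) with i - k′ in i-k′
  ... | -[1+ _ ] = true≢false (sym ε)
  ... | + u = true≢false (trans (sym δ)
                (trans (cong (flip lookupℤ bergman-odd) i-k) (bergman-odd-below (ones-bergman-odd+1 u ε))))
    where
    i-k : i - k ≡ + u - + 2
    i-k = trans (solve 2 (λ i A → i :- (:- A) := (i :- (:- (con (+ 2) :+ A))) :- con (+ 2)) refl i A) (cong (_- + 2) i-k′)
    bergman-odd-below : ∀ {u} → u ≡ 0 ⊎ (Σ ℕ λ j → j < n × u ≡ 3 ℕ.+ (j ℕ.+ j)) ⊎ u ≡ 3 ℕ.+ (a ℕ.+ a) →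
      lookupℤ (+ u - + 2) bergman-odd ≡ false
    bergman-odd-below (inj₁ refl) = refl
    bergman-odd-below (inj₂ (inj₁ (j , j<n , refl))) = nth-alternating++-odd a j _ (ℕP.<-≤-trans j<n (ℕP.m≤m+n n n))
    bergman-odd-below (inj₂ (inj₂ refl)) = nth-vanishes bergman-odd _ (ℕP.≤-reflexive
      (trans (LP.length-++ (alternating a)) (trans (cong (ℕ._+ 1) (length-alternating a)) (ℕP.+-comm (a ℕ.+ a) 1))))

  canonical-even : ∀ {r} → IsCanonical (L a) r → ∀ i → digit r i ≡ digit (k , special-even) i
  canonical-even γr = canonical-special {s = k , special-even} represents-special-even is-special-even γr

  canonical-even+1 : ∀ {r} → IsCanonical (L a ℕ.+ 1) r → ∀ i → digit r i ≡ digit (k , bergman-even+1) i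
  canonical-even+1 γr =
    canonical-bergman {e = k , bergman-even+1}
      (no-special-+1 {e = k , bergman-even} is-bergman-even bergman-even-digit1) is-bergman-even+1 γr

  canonical-odd : ∀ {r} → IsCanonical (L (suc a)) r → ∀ i → digit r i ≡ digit (k , bergman-odd) i
  canonical-odd γr =
    canonical-bergman {e = k , bergman-odd}
      (no-special-10 {e = k , bergman-odd} is-bergman-odd bergman-odd-digit0 bergman-odd-digit1) is-bergman-odd γr

  canonical-odd+1 : ∀ {r} → IsCanonical (L (suc a) ℕ.+ 1) r → ∀ i → digit r i ≡ digit (k′ , bergman-odd+1) i
  canonical-odd+1 γr =
    canonical-bergman {e = k′ , bergman-odd+1}
      (no-special-+1 {e = k , bergman-odd} is-bergman-odd bergman-odd-digit1) is-bergman-odd+1 γr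

  even-case : ∀ r r′ → IsCanonical (L a) r → IsCanonical (L a ℕ.+ 1) r′ →
    ∀ i → (digit r i ≡ true × digit r′ i ≡ true) ⇔ (i ≡ + 0 ⊎ i ≡ k)
  even-case r r′ γr γr′ i = subst₂ (λ x y → (x ≡ true × y ≡ true) ⇔ (i ≡ + 0 ⊎ i ≡ k))
    (sym (canonical-even γr i)) (sym (canonical-even+1 γr′ i)) (common-ones-even i)

  odd-case : ∀ r r′ → IsCanonical (L (suc a)) r → IsCanonical (L (suc a) ℕ.+ 1) r′ →
    ∀ i → ¬ (digit r i ≡ true × digit r′ i ≡ true)
  odd-case r r′ γr γr′ i (d , d′) =
    no-common-ones-odd i (trans (sym (canonical-odd γr i)) d , trans (sym (canonical-odd+1 γr′ i)) d′)

lemma11 : (n : ℕ) → 1 ≤ n →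
    ((r r′ : Rep) → IsCanonical (L (2 * n)) r → IsCanonical (L (2 * n) ℕ.+ 1) r′ →
      (i : ℤ) → ((digit r i ≡ true × digit r′ i ≡ true) ⇔ (i ≡ + 0 ⊎ i ≡ - (+ (2 * n)))))
    × ((r r′ : Rep) → IsCanonical (L (2 * n ℕ.+ 1)) r → IsCanonical (L (2 * n ℕ.+ 1) ℕ.+ 1) r′ →
      (i : ℤ) → - (+ (2 * n ℕ.+ 2)) ℤ.≤ i → i ℤ.≤ + (2 * n ℕ.+ 2) →
      ¬ (digit r i ≡ true × digit r′ i ≡ true))
lemma11 (suc p) _ rewrite ℕP.+-identityʳ (suc p) | ℕP.+-comm (suc p ℕ.+ suc p) 1 =
  even-case , λ r r′ γr γr′ i _ _ → odd-case r r′ γr γr′ i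
  where open LucasDigits p
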